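{- Let $N=p_1p_2\cdots p_m$ be a squarefree composite positive integer with primes $p_1<p_2<\dots<p_m$ ($m\ge 2$). For $k\in\mathbb{Z}\setminus\{ -1\}$ and a prime $p\mid N$ put $M(k,p)=\frac{N+kp}{k+1}$. If $\alpha\in\mathbb{Q}\text{ - }\mathcal{KS}(N)$, then $$M(-m-2,p_1)\le\alpha\le\min\big(M(m-1,p_{m-1}),\,M(m,p_m)\big).$$
   Context: For a positive integer $N\ge 2$, the $\mathbb{Q}$-Korselt set $\mathbb{Q}\text{ - }\mathcal{KS}(N)$ is the set of all rationals $\alpha=\frac{\alpha_1}{\alpha_2}\in\mathbb{Q}\setminus\{0,N\}$ (written with $\alpha_1\in\mathbb{Z}$, $\alpha_2>0$, $\gcd(\alpha_1,\alpha_2)=1$) such that the integer $\alpha_2p-\alpha_1$ divides the integer $\alpha_2N-\alpha_1$ for every prime divisor $p$ of $N$. Its elements are called $N$-Korselt rational bases. -}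

module Defs where

open import Data.Nat as ℕ using (ℕ; zero; suc)
open import Data.Nat.Primality using (Prime)
import Data.Nat.Divisibility as ℕD
open import Data.Integer as ℤ using (ℤ; +_; -[1+_]; +[1+_])
open import Data.Integer.Divisibility using () renaming (_∣_ to _∣ℤ_)
open import Data.Rational using (ℚ; ↥_; ↧_; _/_; 0ℚ)
open import Data.Product using (_×_)
open import Relation.Binary.PropositionalEquality using (_≢_)

ℕ→ℚ : ℕ → ℚ
ℕ→ℚ N = + N / 1

-- α is an N-Korselt rational base: α ∈ ℚ ∖ {0, N}, and writing α = α₁/α₂ in
-- lowest terms (α₁ = ↥ α, α₂ = ↧ α > 0), for every prime p ∣ N we have
-- (α₂ p − α₁) ∣ (α₂ N − α₁) in ℤ.
IsKorseltBase : ℕ → ℚ → Set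
IsKorseltBase N α =
  (α ≢ 0ℚ) × (α ≢ ℕ→ℚ N) ×
  (∀ (p : ℕ) → Prime p → p ℕD.∣ N →
     ((↧ α) ℤ.* (+ p) ℤ.- (↥ α)) ∣ℤ ((↧ α) ℤ.* (+ N) ℤ.- (↥ α)))

-- M(k,p) = (N + k p) / (k + 1) as a rational number, for k ≠ -1.
-- (For k = -1 the value is an irrelevant junk value 0; it is never used.)
M : ℕ → ℤ → ℕ → ℚ
M N k p with k ℤ.+ + 1
... | +[1+ d ] = ((+ N) ℤ.+ k ℤ.* (+ p)) / suc d
... | -[1+ d ] = (ℤ.- ((+ N) ℤ.+ k ℤ.* (+ p))) / suc d
... | + zero   = 0ℚ

-- Write α = a/b in lowest terms and δ x = b x − a, so that the Korselt condition says δ p ∣ δ N for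
-- every prime p ∣ N, and α ≠ N says δ N ≠ 0, which forces δ N > 0 since δ pₘ < δ N. Each of the
-- three bounds is equivalent to an inequality c·d ≤ δ N for a divisor d = ± δ pᵢ. The engine is:
-- if d ∣ D and c·d < D then (c+1)·d ≤ D. Walking up the decreasing divisors −δ p₁ > … > −δ pₘ it
-- gives i·(−δ pᵢ) ≤ δ N, which yields the upper bounds. Walking down the increasing divisors
-- δ pₘ > … > δ p₁ from 3·δ pₘ ≤ δ N, or from 4·δ pₘ₋₁ ≤ δ N, it yields (m+2)·δ p₁ ≤ δ N, the lower
-- bound. Both starts fail only if δ N = 2·δ pₘ = 3·δ pₘ₋₁; then N + 3pₘ₋₁ = 4pₘ, so N = 6 and α = 0.
module Submission where

open import Data.Nat using (ℕ)
open import Data.Rational using (ℚ)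
import Data.Integer as ℤ

module Integers where
  open import Data.Nat using (zero; s≤s; z≤n)
  open import Data.Nat.Divisibility using (∣⇒≤)
  import Data.Nat.Properties as ℕ
  open import Data.Integer using (0ℤ; -[1+_]; +[1+_]; +_; -_; _*_; _-_; _<_; _≤_; -<-; +<+)
  open import Data.Integer.Properties using (0≤i-j⇒j≤i; i≤j⇒0≤j-i)
  open import Data.Integer.Divisibility.Signed using (_∣_; divides; ∣⇒∣ᵤ)
  open import Data.Integer.Tactic.RingSolver using (solve-∀)
  open import Relation.Binary.PropositionalEquality using (_≡_; _≢_; refl; trans; subst)
  open import Relation.Nullary using (contradiction)

  ≤-by-difference : ∀ {i j k l} → j - i ≡ l - k → i ≤ j → k ≤ l
  ≤-by-difference eq i≤j = 0≤i-j⇒j≤i (subst (0ℤ ≤_) eq (i≤j⇒0≤j-i i≤j))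

  i∣j⇒-i∣j : ∀ {i j} → i ∣ j → - i ∣ j
  i∣j⇒-i∣j {i} (divides q j≡qi) = divides (- q) (trans j≡qi (negate-both q i))
    where
    negate-both : ∀ q i → q * i ≡ (- q) * (- i)
    negate-both = solve-∀

  i∣j∧i<j⇒0<j : ∀ {i j} → i ∣ j → j ≢ 0ℤ → i < j → 0ℤ < j
  i∣j∧i<j⇒0<j {j = +[1+ _ ]} _ _ _ = +<+ (s≤s z≤n)
  i∣j∧i<j⇒0<j {j = + zero} _ j≢0 _ = contradiction refl j≢0
  i∣j∧i<j⇒0<j { -[1+ m ]} { -[1+ n ]} i∣j _ (-<- n<m) =
    contradiction (∣⇒≤ (∣⇒∣ᵤ i∣j)) (ℕ.<⇒≱ (s≤s n<m))

module DivisorMultiples {D : ℤ.ℤ} (0<D : ℤ.0ℤ ℤ.< D) where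
  open import Data.Nat as ℕ using (zero; suc)
  open import Data.Fin using (Fin; zero; suc; fromℕ; inject₁)
  open import Data.Integer using (ℤ; 0ℤ; +_; _*_; _<_; _≤_; nonNegative)
  open import Data.Integer.Properties
  open import Data.Integer.Divisibility.Signed using (_∣_; divides)
  open import Data.Product using (_×_; _,_)
  open import Data.Sum using (_⊎_; inj₁; inj₂)
  open import Function using (_∘_)
  open import Relation.Binary.PropositionalEquality using (_≡_; sym; subst; refl)
  open import Relation.Nullary using (yes; no)

  next-multiple-≤ : ∀ {d} c → d ∣ D → + c * d < D → + suc c * d ≤ D
  next-multiple-≤ {d} c (divides q refl) cd<qd with 0ℤ <? d
  ... | yes 0<d = *-monoʳ-≤-nonNeg d {+ suc c} {q} (i<j⇒suc[i]≤j {+ c} (*-cancelʳ-<-nonNeg d cd<qd))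
    where instance _ = nonNegative (<⇒≤ 0<d)
  ... | no d≯0 = ≤-trans (subst (+ suc c * d ≤_) (*-zeroʳ (+ suc c)) (*-monoˡ-≤-nonNeg (+ suc c) (≮⇒≥ d≯0)))
                         (<⇒≤ 0<D)

  smaller-divisor-multiple-≤ : ∀ {d e} c → e < d → e ∣ D → + suc c * d ≤ D → + suc (suc c) * e ≤ D
  smaller-divisor-multiple-≤ c e<d e∣D cd≤D =
    next-multiple-≤ (suc c) e∣D (<-≤-trans (*-monoˡ-<-pos (+ suc c) e<d) cd≤D)

  decreasing-divisors-multiple-≤ : ∀ {k} (d : Fin (suc k) → ℤ)
    → (∀ i → d (suc i) < d (inject₁ i)) → (∀ i → d i ∣ D) → + suc k * d (fromℕ k) ≤ D
  decreasing-divisors-multiple-≤ {zero} d _ d∣D = next-multiple-≤ 0 (d∣D zero) 0<D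
  decreasing-divisors-multiple-≤ {suc k} d dec d∣D =
    smaller-divisor-multiple-≤ k (dec (fromℕ k)) (d∣D (fromℕ (suc k)))
      (decreasing-divisors-multiple-≤ (d ∘ inject₁) (dec ∘ inject₁) (d∣D ∘ inject₁))

  increasing-divisors-multiple-≤ : ∀ {k} c (d : Fin (suc k) → ℤ)
    → (∀ i → d (inject₁ i) < d (suc i)) → (∀ i → d i ∣ D)
    → + suc c * d (fromℕ k) ≤ D → + suc (k ℕ.+ c) * d zero ≤ D
  increasing-divisors-multiple-≤ {zero} c d _ _ cd≤D = cd≤D
  increasing-divisors-multiple-≤ {suc k} c d inc d∣D cd≤D =
    smaller-divisor-multiple-≤ (k ℕ.+ c) (inc zero) (d∣D zero)
      (increasing-divisors-multiple-≤ c (d ∘ suc) (inc ∘ suc) (d∣D ∘ suc) cd≤D)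

  divisor-pair-multiples : ∀ {x y} → x < y → y < D → x ∣ D → y ∣ D
    → (+ 3 * y ≤ D) ⊎ (+ 4 * x ≤ D) ⊎ (+ 2 * y ≡ D × + 3 * x ≡ D)
  divisor-pair-multiples {x} {y} x<y y<D x∣D y∣D with + 2 * y ≟ D
  ... | no 2y≢D = inj₁ (next-multiple-≤ 2 y∣D (≤∧≢⇒< 2y≤D 2y≢D))
    where
    2y≤D : + 2 * y ≤ D
    2y≤D = next-multiple-≤ 1 y∣D (subst (_< D) (sym (*-identityˡ y)) y<D)
  ... | yes 2y≡D with + 3 * x ≟ D
  ...   | yes 3x≡D = inj₂ (inj₂ (2y≡D , 3x≡D))
  ...   | no 3x≢D = inj₂ (inj₁ (next-multiple-≤ 3 x∣D (≤∧≢⇒< 3x≤D 3x≢D)))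
    where
    3x≤D : + 3 * x ≤ D
    3x≤D = smaller-divisor-multiple-≤ 1 x<y x∣D (≤-reflexive 2y≡D)

module ExceptionalEquation where
  open import Data.Nat
  open import Data.Nat.Properties
  open import Data.Nat.Divisibility using (_∣_; divides)
  open import Data.Nat.Primality using (Prime; prime?)
  open import Data.Nat.Tactic.RingSolver using (solve)
  open import Data.List using (_∷_; [])
  open import Relation.Nullary using (contradiction)
  open import Relation.Nullary.Decidable using (from-no)
  open import Relation.Binary.PropositionalEquality

  private
    +-pos-≢ : ∀ {m n} o → m ≤ n → 0 < o → n + o ≢ m
    +-pos-≢ {n = n} o m≤n 0<o eq = <-irrefl (sym eq) (≤-<-trans m≤n (m<m+n n 0<o))

  N+3x≡4y⇒N≡2y : ∀ {N x y} → 2 ≤ x → x < y → Prime y → x * y ∣ N → N + 3 * x ≡ 4 * y → N ≡ 2 * y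
  N+3x≡4y⇒N≡2y {x = x} {y} _ x<y _ (divides zero refl) eq =
    contradiction eq (<⇒≢ (<-≤-trans (*-monoʳ-< 3 x<y) (*-monoˡ-≤ y {3} {4} (s≤s (s≤s (s≤s z≤n))))))
  N+3x≡4y⇒N≡2y {x = x} {y} 2≤x _ _ (divides (suc (suc L)) refl) eq =
    contradiction eq (+-pos-≢ (3 * x) 4y≤N (*-monoʳ-< 3 (≤-trans (s≤s z≤n) 2≤x)))
    where
    4y≤N : 4 * y ≤ suc (suc L) * (x * y)
    4y≤N = begin
      4 * y                ≡⟨ *-assoc 2 2 y ⟩
      2 * (2 * y)          ≤⟨ *-monoʳ-≤ 2 (*-monoˡ-≤ y 2≤x) ⟩
      2 * (x * y)          ≤⟨ *-monoˡ-≤ (x * y) {2} {suc (suc L)} (s≤s (s≤s z≤n)) ⟩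
      suc (suc L) * (x * y) ∎
      where open ≤-Reasoning
  N+3x≡4y⇒N≡2y {x = 1} (s≤s ()) _ _ (divides 1 refl) _
  N+3x≡4y⇒N≡2y {x = 2} {y} _ _ _ (divides 1 refl) _ = *-identityˡ (2 * y)
  N+3x≡4y⇒N≡2y {x = 3} {y} _ _ y-prime (divides 1 refl) eq =
    contradiction (subst Prime y≡9 y-prime) (from-no (prime? 9))
    where
    y≡9 : y ≡ 9
    y≡9 = +-cancelˡ-≡ (3 * y) y 9 (begin
      3 * y + y            ≡⟨ solve (y ∷ []) ⟩
      4 * y                ≡⟨ eq ⟨
      1 * (3 * y) + 3 * 3  ≡⟨ solve (y ∷ []) ⟩
      3 * y + 9            ∎)
      where open ≡-Reasoning
  N+3x≡4y⇒N≡2y {x = x@(suc (suc (suc (suc _))))} {y} _ _ _ (divides 1 refl) eq =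
    contradiction eq (+-pos-≢ (3 * x) 4y≤N (s≤s z≤n))
    where
    4y≤N : 4 * y ≤ 1 * (x * y)
    4y≤N = ≤-trans (*-monoˡ-≤ y {4} {x} (s≤s (s≤s (s≤s (s≤s z≤n)))))
                   (≤-reflexive (sym (*-identityˡ (x * y))))

module RationalFractions where
  open import Defs using (ℕ→ℚ)
  open import Data.Nat using (suc; s≤s; z≤n)
  open import Data.Integer using (0ℤ; +_; +<+)
  import Data.Integer.Properties as ℤ
  open import Data.Rational using (mkℚ; ↥_; ↧_; _/_; _≤_)
  open import Data.Rational.Properties using (toℚᵘ-cancel-≤; toℚᵘ-fromℚᵘ; toℚᵘ-injective)
  import Data.Rational.Unnormalised as ℚᵘ
  import Data.Rational.Unnormalised.Properties as ℚᵘ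
  open import Relation.Binary.PropositionalEquality using (_≡_; trans)

  0<↧ : ∀ q → 0ℤ ℤ.< ↧ q
  0<↧ (mkℚ _ _ _) = +<+ (s≤s z≤n)

  /-≤ : ∀ x d q → x ℤ.* ↧ q ℤ.≤ ↥ q ℤ.* + suc d → x / suc d ≤ q
  /-≤ x d q@(mkℚ _ _ _) x↧q≤↥qd =
    toℚᵘ-cancel-≤ (ℚᵘ.≤-trans (ℚᵘ.≤-reflexive (toℚᵘ-fromℚᵘ (ℚᵘ.mkℚᵘ x d))) (ℚᵘ.*≤* x↧q≤↥qd))

  ≤-/ : ∀ x d q → ↥ q ℤ.* + suc d ℤ.≤ x ℤ.* ↧ q → q ≤ x / suc d
  ≤-/ x d q@(mkℚ _ _ _) ↥qd≤x↧q =
    toℚᵘ-cancel-≤ (ℚᵘ.≤-trans (ℚᵘ.*≤* ↥qd≤x↧q) (ℚᵘ.≤-reflexive (ℚᵘ.≃-sym (toℚᵘ-fromℚᵘ (ℚᵘ.mkℚᵘ x d)))))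

  ↥≡↧*n⇒≡ℕ→ℚ : ∀ q n → ↥ q ≡ ↧ q ℤ.* + n → q ≡ ℕ→ℚ n
  ↥≡↧*n⇒≡ℕ→ℚ q@(mkℚ _ _ _) n ↥q≡↧qn =
    toℚᵘ-injective (ℚᵘ.≃-trans
      (ℚᵘ.*≡* (trans (ℤ.*-identityʳ (↥ q)) (trans ↥q≡↧qn (ℤ.*-comm (↧ q) (+ n)))))
      (ℚᵘ.≃-sym (toℚᵘ-fromℚᵘ (ℚᵘ.mkℚᵘ (+ n) 0))))

module PrimeVectors where
  open import Data.Nat using (zero; suc; _*_; _<_)
  open import Data.Nat.Properties using (*-identityʳ; *-comm; <-≤-trans; m<m*n)
  open import Data.Nat.Divisibility using (_∣_; ∣-reflexive; ∣-trans; n∣m*n; ∣⇒≤)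
  open import Data.Nat.ListAction using (product)
  open import Data.Nat.Primality using (Prime; prime⇒nonZero; productOfPrimes≢0)
  open import Data.Fin using (fromℕ; inject₁)
  open import Data.Vec using (Vec; _∷_; []; lookup; toList)
  open import Data.Vec.Relation.Unary.All.Properties using (lookup⁻; toList⁺)
  open import Relation.Binary.PropositionalEquality using (cong; sym; subst)

  last-two-∣-product : ∀ {n} (v : Vec ℕ (suc (suc n)))
    → lookup v (inject₁ (fromℕ n)) * lookup v (fromℕ (suc n)) ∣ product (toList v)
  last-two-∣-product {zero} (x ∷ y ∷ []) = ∣-reflexive (cong (x *_) (sym (*-identityʳ y)))
  last-two-∣-product {suc n} (x ∷ v) = ∣-trans (last-two-∣-product v) (n∣m*n x)

  last-<-product : ∀ {n} (v : Vec ℕ (suc (suc n))) → (∀ i → Prime (lookup v i))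
    → 1 < lookup v (inject₁ (fromℕ n)) → lookup v (fromℕ (suc n)) < product (toList v)
  last-<-product {n} v primes 1<x =
    <-≤-trans y<x*y (∣⇒≤ {{productOfPrimes≢0 (toList⁺ (lookup⁻ {xs = v} primes))}} (last-two-∣-product v))
    where
    x y : ℕ
    x = lookup v (inject₁ (fromℕ n))
    y = lookup v (fromℕ (suc n))
    y<x*y : y < x * y
    y<x*y = subst (y <_) (*-comm y x) (m<m*n y x {{prime⇒nonZero (primes (fromℕ (suc n)))}} 1<x)

module Korselt (N : ℕ) (α : ℚ) where
  open import Defs using (M; ℕ→ℚ)
  open import Data.Nat as ℕ using (suc)
  import Data.Nat.Properties as ℕ
  import Data.Nat.Divisibility as ℕ
  open import Data.Nat.Primality using (Prime)
  open import Data.Fin using (Fin; zero; suc; fromℕ; inject₁)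
  open import Data.Integer using (ℤ; 0ℤ; 1ℤ; +_; -[1+_]; _*_; _+_; _-_; -_; _<_; _≤_)
  import Data.Integer.Properties as ℤ
  open import Data.Integer.Divisibility.Signed using (_∣_)
  open import Data.Integer.Tactic.RingSolver using (solve-∀)
  open import Data.Rational using (0ℚ; ↥_; ↧_) renaming (_≤_ to _≤ℚ_)
  open import Data.Rational.Properties using (↥p≡0⇒p≡0)
  open import Data.Product using (_×_; _,_)
  open import Data.Sum using (inj₁; inj₂)
  open import Function using (_∘_)
  open import Relation.Binary.PropositionalEquality
  open import Relation.Nullary using (¬_; contradiction)
  open Integers
  open RationalFractions
  open ExceptionalEquation

  δ : ℕ → ℤ
  δ x = ↧ α * + x - ↥ α

  Exceptional : ℕ → ℕ → Set
  Exceptional x y = + 2 * δ y ≡ δ N × + 3 * δ x ≡ δ N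

  δ-mono-< : ∀ {x y} → x ℕ.< y → δ x < δ y
  δ-mono-< x<y = ℤ.+-monoˡ-< (- ↥ α) (ℤ.*-monoˡ-<-pos (↧ α) {{ℤ.positive (0<↧ α)}} (ℤ.+<+ x<y))

  δN≢0 : α ≢ ℕ→ℚ N → δ N ≢ 0ℤ
  δN≢0 α≢N δN≡0 = α≢N (↥≡↧*n⇒≡ℕ→ℚ α N (sym (ℤ.i-j≡0⇒i≡j _ _ δN≡0)))

  ≤-M : ∀ K p → + suc K * - δ p ≤ δ N → α ≤ℚ M N (+ suc K) p
  ≤-M K p h = ≤-/ (+ N + + suc K * + p) (K ℕ.+ 1) α
    (≤-by-difference (identity (↥ α) (↧ α) (+ N) (+ p) (+ suc K)) h)
    where
    identity : ∀ a b n p k → (b * n - a) - k * - (b * p - a) ≡ (n + k * p) * b - a * (k + 1ℤ)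
    identity = solve-∀

  M-≤ : ∀ c p → + suc (suc c) * δ p ≤ δ N → M N -[1+ suc c ] p ≤ℚ α
  M-≤ c p h = /-≤ (- (+ N + -[1+ suc c ] * + p)) c α
    (≤-by-difference (identity (↥ α) (↧ α) (+ N) (+ p) (+ suc (suc c))) h)
    where
    identity : ∀ a b n p k → (b * n - a) - k * (b * p - a) ≡ a * (k - 1ℤ) - (- (n + (- k) * p)) * b
    identity = solve-∀

  exceptional⇒N+3x≡4y : ∀ x y → Exceptional x y → N ℕ.+ 3 ℕ.* x ≡ 4 ℕ.* y
  exceptional⇒N+3x≡4y x y (2δy≡δN , 3δx≡δN) = ℤ.+-injective (begin
    + N + + (3 ℕ.* x)   ≡⟨ cong (λ t → + N + t) (ℤ.pos-* 3 x) ⟩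
    + N + + 3 * + x     ≡⟨ ℤ.*-cancelˡ-≡ (↧ α) _ _ {{ℤ.>-nonZero (0<↧ α)}} scaled ⟩
    + 4 * + y           ≡⟨ ℤ.pos-* 4 y ⟨
    + (4 ℕ.* y)         ∎)
    where
    open ≡-Reasoning
    expand-left : ∀ a b n x → b * (n + + 3 * x) ≡ (+ 3 * (b * x - a) + (b * n - a)) + + 4 * a
    expand-left = solve-∀
    expand-right : ∀ a b y → (+ 2 * (b * y - a) + + 2 * (b * y - a)) + + 4 * a ≡ b * (+ 4 * y)
    expand-right = solve-∀
    scaled : ↧ α * (+ N + + 3 * + x) ≡ ↧ α * (+ 4 * + y)
    scaled = begin
      ↧ α * (+ N + + 3 * + x)               ≡⟨ expand-left (↥ α) (↧ α) (+ N) (+ x) ⟩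
      (+ 3 * δ x + δ N) + + 4 * ↥ α         ≡⟨ cong (λ t → (t + δ N) + + 4 * ↥ α) 3δx≡δN ⟩
      (δ N + δ N) + + 4 * ↥ α               ≡⟨ cong (λ t → (t + t) + + 4 * ↥ α) 2δy≡δN ⟨
      (+ 2 * δ y + + 2 * δ y) + + 4 * ↥ α   ≡⟨ expand-right (↥ α) (↧ α) (+ y) ⟩
      ↧ α * (+ 4 * + y)                     ∎

  2δy≡δ[2y]⇒↥α≡0 : ∀ y → + 2 * δ y ≡ δ (2 ℕ.* y) → ↥ α ≡ 0ℤ
  2δy≡δ[2y]⇒↥α≡0 y 2δy≡δ2y = begin
    ↥ α                                    ≡⟨ identity (↥ α) (↧ α) (+ y) ⟩
    (↧ α * (+ 2 * + y) - ↥ α) - + 2 * δ y  ≡⟨ cong₂ _-_ (cong (λ t → ↧ α * t - ↥ α) (sym (ℤ.pos-* 2 y)))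
                                                        2δy≡δ2y ⟩
    δ (2 ℕ.* y) - δ (2 ℕ.* y)              ≡⟨ ℤ.+-inverseʳ (δ (2 ℕ.* y)) ⟩
    0ℤ                                     ∎
    where
    open ≡-Reasoning
    identity : ∀ a b y → a ≡ (b * (+ 2 * y) - a) - + 2 * (b * y - a)
    identity = solve-∀

  ¬exceptional : ∀ {x y} → α ≢ 0ℚ → 2 ℕ.≤ x → x ℕ.< y → Prime y → x ℕ.* y ℕ.∣ N → ¬ Exceptional x y
  ¬exceptional {x} {y} α≢0 2≤x x<y y-prime xy∣N exc@(2δy≡δN , _) =
    α≢0 (↥p≡0⇒p≡0 α (2δy≡δ[2y]⇒↥α≡0 y (trans 2δy≡δN (cong δ N≡2y))))
    where
    N≡2y : N ≡ 2 ℕ.* y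
    N≡2y = N+3x≡4y⇒N≡2y 2≤x x<y y-prime xy∣N (exceptional⇒N+3x≡4y x y exc)

  module _ (0<δN : 0ℤ < δ N) where
    open DivisorMultiples 0<δN

    upper-multiple : ∀ {k} (p : Fin (suc k) → ℕ) → (∀ i → p (inject₁ i) ℕ.< p (suc i))
      → (∀ i → δ (p i) ∣ δ N) → + suc k * - δ (p (fromℕ k)) ≤ δ N
    upper-multiple p inc δp∣δN =
      decreasing-divisors-multiple-≤ (λ i → - δ (p i)) (ℤ.neg-mono-< ∘ δ-mono-< ∘ inc) (i∣j⇒-i∣j ∘ δp∣δN)

    lower-multiple : ∀ {n} (p : Fin (suc (suc n)) → ℕ) → (∀ i → p (inject₁ i) ℕ.< p (suc i))
      → (∀ i → δ (p i) ∣ δ N) → p (fromℕ (suc n)) ℕ.< N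
      → ¬ Exceptional (p (inject₁ (fromℕ n))) (p (fromℕ (suc n)))
      → + suc (suc (n ℕ.+ 2)) * δ (p zero) ≤ δ N
    lower-multiple {n} p inc δp∣δN last<N ¬exc
      with divisor-pair-multiples (δ-mono-< (inc (fromℕ n))) (δ-mono-< last<N) (δp∣δN _) (δp∣δN _)
    ... | inj₁ 3δlast≤δN = increasing-divisors-multiple-≤ 2 (δ ∘ p) (δ-mono-< ∘ inc) δp∣δN 3δlast≤δN
    ... | inj₂ (inj₁ 4δprev≤δN) = subst (λ c → + suc c * δ (p zero) ≤ δ N) (ℕ.+-suc n 2)
          (increasing-divisors-multiple-≤ 3 (δ ∘ p ∘ inject₁) (δ-mono-< ∘ inc ∘ inject₁) (δp∣δN ∘ inject₁)
                                          4δprev≤δN)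
    ... | inj₂ (inj₂ exc) = contradiction exc ¬exc

open import Defs
open import Data.Nat using (ℕ; _<_; suc)
open import Data.Nat.Primality using (Prime)
open import Data.Nat.ListAction using (product)
open import Data.Fin using (Fin; zero; fromℕ; inject₁) renaming (_<_ to _<ᶠ_)
open import Data.Vec using (Vec; lookup; toList)
open import Data.Integer using (+_; -_) renaming (_+_ to _+ℤ_; _-_ to _-ℤ_)
open import Data.Rational using (ℚ; _≤_; _⊓_)
open import Data.Product using (_×_)
open import Relation.Binary.PropositionalEquality using (_≡_)

open import Data.Nat using (_+_; nonTrivial⇒n>1)
open import Data.Nat.ListAction.Properties using (∈⇒∣product)
open import Data.Nat.Primality using (prime⇒nonTrivial)
open import Data.Fin using (suc)
open import Data.Fin.Properties using (≤̄⇒inject₁<; ≤-refl)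
open import Data.Vec.Membership.Propositional.Properties using (∈-lookup; ∈-toList⁺)
open import Data.Integer using (0ℤ) renaming (_<_ to _<ℤ_)
open import Data.Integer.Divisibility.Signed using (∣ᵤ⇒∣) renaming (_∣_ to _∣ℤ_)
open import Data.Rational.Properties using (⊓-glb)
open import Data.Product using (_,_)
open import Function using (_∘_)
open import Relation.Binary.PropositionalEquality using (refl)
open import Relation.Nullary using (¬_)
open Integers
open PrimeVectors

theorem2p5 : (n : ℕ) (ps : Vec ℕ (suc (suc n))) (N : ℕ)
    → (∀ i → Prime (lookup ps i))
    → (∀ i j → i <ᶠ j → lookup ps i < lookup ps j)
    → N ≡ product (toList ps)
    → (α : ℚ) → IsKorseltBase N α
    → (M N (- (+ suc (suc n) +ℤ + 2)) (lookup ps zero) ≤ α)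
      × (α ≤ (M N (+ suc (suc n) -ℤ + 1) (lookup ps (inject₁ (fromℕ n)))
              ⊓ M N (+ suc (suc n)) (lookup ps (fromℕ (suc n)))))
theorem2p5 n ps N primes increasing refl α (α≢0 , α≢N , korselt) =
  M-≤ (n + 2) (p zero) (lower-multiple 0<δN p adjacent δp∣δN last<N ¬exceptional-last-two)
  , ⊓-glb (≤-M n (p prev) (upper-multiple 0<δN (p ∘ inject₁) (adjacent ∘ inject₁) (δp∣δN ∘ inject₁)))
          (≤-M (suc n) (p last) (upper-multiple 0<δN p adjacent δp∣δN))
  where
  open Korselt N α
  p : Fin (suc (suc n)) → ℕ
  p = lookup ps
  prev last : Fin (suc (suc n))
  prev = inject₁ (fromℕ n)
  last = fromℕ (suc n)
  1<p : ∀ i → 1 < p i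
  1<p i = nonTrivial⇒n>1 (p i) {{prime⇒nonTrivial (primes i)}}
  adjacent : ∀ i → p (inject₁ i) < p (suc i)
  adjacent i = increasing _ _ (≤̄⇒inject₁< (≤-refl {x = i}))
  δp∣δN : ∀ i → δ (p i) ∣ℤ δ N
  δp∣δN i = ∣ᵤ⇒∣ (korselt (p i) (primes i) (∈⇒∣product (∈-toList⁺ (∈-lookup i ps))))
  last<N : p last < N
  last<N = last-<-product ps primes (1<p prev)
  0<δN : 0ℤ <ℤ δ N
  0<δN = i∣j∧i<j⇒0<j (δp∣δN last) (δN≢0 α≢N) (δ-mono-< last<N)
  ¬exceptional-last-two : ¬ Exceptional (p prev) (p last)
  ¬exceptional-last-two = ¬exceptional α≢0 (1<p prev) (adjacent (fromℕ n)) (primes last) (last-two-∣-product ps)
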